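{- Let $\pi\in\mathbb{C}(3,3)$ have at least one odd part. Then there exists a unique integer $m\ge0$ such that $\pi\in\mathbb{C}_{=}(3,3|m)$.
   Context: A partition is a finite non-increasing sequence of positive integers. $\mathbb{C}(k,r)$ is the set of partitions $\pi=(\pi_1,\dots,\pi_\ell)$ with no repeated odd part, $\pi_i\ge\pi_{i+k-1}+2$ for $1\le i\le\ell-k+1$ (strict if $\pi_i$ even), and at most $r-1$ parts $\le2$; here $k=r=3$. Göllnitz–Gordon marking $GG(\pi)$: marks (positive integers) are assigned to the parts from smallest to largest, each as small as possible subject to: the mark of $\pi_i$ differs from the marks of all parts $\pi_g$, $g>i$, with $\pi_i-\pi_g\le2$ (strict if $\pi_i$ odd). A "$j$-marked $x$" is a part $x$ with mark $j$. $N_j$ is the number of $j$-marked parts and $\pi^{(j)}_1>\cdots>\pi^{(j)}_{N_j}$ are these parts; $\pi^{(j)}_0=+\infty$, $\pi^{(j)}_{N_j+1}=-\infty$. Starting types (for $N_2\ge1$): let $l$ be the largest integer $0\le l\le N_2$ such that no odd part of $\pi$ is $\ge\pi^{(2)}_l$; parts $\pi^{(2)}_i$, $i>l$, are of type $s_{ -1}$. For $b=1$: $\pi^{(2)}_1$ is of type $s_0$ [resp. $s_1$] with $s_1(\pi)=\pi^{(2)}_1-1$ [resp. $-2$] if there is a 1-marked $\pi^{(2)}_1-1$ [resp. $\pi^{(2)}_1-2$] and $\pi^{(2)}_1+2$ does not occur; of type $s_2$ ($s_1(\pi)=\pi^{(2)}_1+2$) if there is a 1-marked $\pi^{(2)}_1+2$;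 of type $s_3$ ($s_1(\pi)=\pi^{(2)}_1$) if there is a 1-marked $\pi^{(2)}_1$. For $b=2,\dots,l$: type $s_0$ [resp. $s_1$], $s_b(\pi)=\pi^{(2)}_b-1$ [resp. $-2$], if there is a 1-marked $\pi^{(2)}_b-1$ [resp. $-2$] and, whenever a 1-marked $\pi^{(2)}_b+2$ exists, $s_{b-1}(\pi)=\pi^{(2)}_b+2$; type $s_2$ ($s_b(\pi)=\pi^{(2)}_b+2$) if there is a 1-marked $\pi^{(2)}_b+2$ and $s_{b-1}(\pi)\neq\pi^{(2)}_b+2$; type $s_3$ ($s_b(\pi)=\pi^{(2)}_b$) if there is a 1-marked $\pi^{(2)}_b$. For $p,t\ge0$, $\mathbb{C}_{=}(k,r|p,t)$ is the set of $\pi\in\mathbb{C}(k,r)$ such that: (1) the largest odd part of $\pi$ is $2t+1$; (2) the mark of $2t+1$ in $GG(\pi)$ is at most 2; (3) $\pi^{(2)}_p\ge 2t+2$ and $\pi^{(2)}_{p+1}\le 2t+2$; (4) if there is a 2-marked $2t+2$ of starting type $s_0$, then $\pi^{(2)}_{p+1}=2t+2$ and there exists $i\le p+1$ with $\pi^{(2)}_i=\pi^{(2)}_{p+1}+4(p-i+1)$ and $\pi^{(2)}_i$ occurring exactly once in $\pi$; (5) if there is a 2-marked $2t+2$ of starting type $s_2$, then $\pi^{(2)}_p=2t+2$; (6) if $2t+2$ occurs in $\pi$ and there is no 2-marked $2t+2$, then $\pi^{(2)}_p=2t+4$ is of starting type $s_3$ and there exists $i\le p$ with $\pi^{(2)}_i=\pi^{(2)}_p+4(p-i)$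 and $\pi^{(2)}_i+2$ not occurring in $\pi$. For $m\ge0$, $\mathbb{C}_{=}(k,r|m)=\bigcup_{p,t\ge0,\,p+t=m}\mathbb{C}_{=}(k,r|p,t)$. -}

module Defs where

open import Data.Nat using (ℕ; zero; suc; _+_; _*_; _∸_; _≤_; _<_; _≥_; _>_; _⊔_; _≡ᵇ_; _≤ᵇ_; _<ᵇ_; _%_)
open import Data.Bool using (Bool; true; false; _∧_; _∨_; not; if_then_else_; T)
open import Data.List using (List; []; _∷_; length; reverse; map; filterᵇ; upTo; foldr)
open import Data.Bool.ListAction using (any; all)
open import Data.List.Membership.Propositional using (_∈_)
open import Data.List.Relation.Unary.All using (All)
open import Data.List.Relation.Unary.Linked using (Linked)
open import Data.Maybe using (Maybe; just; nothing)
open import Data.Product using (_×_; _,_; proj₁; proj₂; ∃; ∃-syntax; ∃!)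
open import Data.Empty using (⊥)
open import Data.Unit using (⊤)
open import Relation.Nullary using (¬_)
open import Relation.Binary.PropositionalEquality using (_≡_)

Odd : ℕ → Set
Odd n = n % 2 ≡ 1

Even : ℕ → Set
Even n = n % 2 ≡ 0

oddᵇ : ℕ → Bool
oddᵇ n = (n % 2) ≡ᵇ 1

IsPartition : List ℕ → Set
IsPartition π = All (λ x → 1 ≤ x) π × Linked _≥_ π

-- 1-based access to the parts (default 0 outside 1..ℓ; only used in range)
nth : List ℕ → ℕ → ℕ
nth []       _             = 0
nth (x ∷ xs) zero          = 0
nth (x ∷ xs) (suc zero)    = x
nth (x ∷ xs) (suc (suc i)) = nth xs (suc i)

count : ℕ → List ℕ → ℕ
count x π = length (filterᵇ (λ y → y ≡ᵇ x) π)

InC33 : List ℕ → Set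
InC33 π =
  IsPartition π
  × (∀ x → Odd x → count x π ≤ 1)
  × (∀ i → 1 ≤ i → i + 2 ≤ length π →
        (nth π i ≥ nth π (i + 2) + 2)
        × (Even (nth π i) → nth π i > nth π (i + 2) + 2))
  -- at most r - 1 = 2 parts ≤ 2
  × (length (filterᵇ (λ x → x ≤ᵇ 2) π) ≤ 2)

-- least n' ≥ n not in L (fuel suffices when fuel > length L)
firstFree : ℕ → ℕ → List ℕ → ℕ
firstFree zero     n L = n
firstFree (suc f)  n L = if any (λ y → y ≡ᵇ n) L then firstFree f (suc n) L else n

-- "π_i - π_g ≤ 2 (strict if π_i odd)" for π_g ≤ π_i
closeᵇ : ℕ → ℕ → Bool
closeᵇ x y = if oddᵇ x then (x ∸ y) <ᵇ 2 else (x ∸ y) ≤ᵇ 2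

-- smallest positive mark differing from the marks of all already
-- marked (smaller or equal, later-indexed) parts close to x
newMark : List (ℕ × ℕ) → ℕ → ℕ
newMark prev x = firstFree (suc (length forb)) 1 forb
  where
  forb : List ℕ
  forb = map proj₂ (filterᵇ (λ p → closeᵇ x (proj₁ p)) prev)

-- process parts from smallest to largest (i.e. index ℓ down to 1)
ggAsc : List (ℕ × ℕ) → List ℕ → List (ℕ × ℕ)
ggAsc prev []       = []
ggAsc prev (x ∷ xs) = (x , newMark prev x) ∷ ggAsc ((x , newMark prev x) ∷ prev) xs

-- GG(π): list of pairs (part, mark), in the order π₁, …, π_ℓ
GG : List ℕ → List (ℕ × ℕ)
GG π = reverse (ggAsc [] (reverse π))

-- the j-marked parts π^(j)_1 > … > π^(j)_{N_j}
marked : ℕ → List ℕ → List ℕ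
marked j π = map proj₁ (filterᵇ (λ p → proj₂ p ≡ᵇ j) (GG π))

N : ℕ → List ℕ → ℕ
N j π = length (marked j π)

-- Extended values: π^(j)_0 = +∞, π^(j)_{N_j+1} = -∞

data ℕ∞ : Set where
  -∞  : ℕ∞
  fin : ℕ → ℕ∞
  +∞  : ℕ∞

_≥∞_ : ℕ∞ → ℕ → Set
-∞    ≥∞ n = ⊥
fin a ≥∞ n = a ≥ n
+∞    ≥∞ n = ⊤

_≤∞_ : ℕ∞ → ℕ → Set
-∞    ≤∞ n = ⊤
fin a ≤∞ n = a ≤ n
+∞    ≤∞ n = ⊥

-- π^(j)_i  (indices > N_j + 1 are not meaningful; we send them to -∞,
-- which makes every condition of the definition below fail/vacuous
-- exactly as if they were undefined)
mk : ℕ → List ℕ → ℕ → ℕ∞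
mk j π zero    = +∞
mk j π (suc i) = if suc i ≤ᵇ N j π then fin (nth (marked j π) (suc i)) else -∞

_≤∞ᵇ_ : ℕ∞ → ℕ → Bool
-∞    ≤∞ᵇ n = true
fin a ≤∞ᵇ n = a ≤ᵇ n
+∞    ≤∞ᵇ n = false

data SType : Set where
  s₋₁ s₀ s₁ s₂ s₃ : SType

occursᵇ : ℕ → List ℕ → Bool
occursᵇ x π = any (λ y → y ≡ᵇ x) π

oneMarkedᵇ : ℕ → List ℕ → Bool
oneMarkedᵇ x π = any (λ p → (proj₁ p ≡ᵇ x) ∧ (proj₂ p ≡ᵇ 1)) (GG π)

-- l : the largest 0 ≤ l ≤ N₂ such that no odd part of π is ≥ π^(2)_l
lCond : List ℕ → ℕ → Bool
lCond π l = all (λ x → not (oddᵇ x ∧ (mk 2 π l ≤∞ᵇ x))) π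

lIdx : List ℕ → ℕ
lIdx π = foldr _⊔_ 0 (filterᵇ (lCond π) (upTo (suc (N 2 π))))

maybeEqᵇ : Maybe ℕ → ℕ → Bool
maybeEqᵇ (just a) n = a ≡ᵇ n
maybeEqᵇ nothing  n = false

sval : Maybe (SType × ℕ) → Maybe ℕ
sval (just (_ , v)) = just v
sval nothing        = nothing

-- type and value s_b(π) of π^(2)_b for 1 ≤ b ≤ l (nothing if no type applies)
stTyped : List ℕ → ℕ → Maybe (SType × ℕ)
stTyped π zero = nothing
stTyped π (suc zero) =
  if oneMarkedᵇ (x ∸ 1) π ∧ not (occursᵇ (x + 2) π) then just (s₀ , x ∸ 1)
  else if oneMarkedᵇ (x ∸ 2) π ∧ not (occursᵇ (x + 2) π) then just (s₁ , x ∸ 2)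
  else if oneMarkedᵇ (x + 2) π then just (s₂ , x + 2)
  else if oneMarkedᵇ x π then just (s₃ , x)
  else nothing
  where
  x : ℕ
  x = nth (marked 2 π) 1
stTyped π (suc (suc b)) = stStep (nth (marked 2 π) (suc (suc b))) (sval (stTyped π (suc b)))
  where
  -- x = π^(2)_b, prev = s_{b-1}(π)
  stStep : ℕ → Maybe ℕ → Maybe (SType × ℕ)
  stStep x prev =
    if oneMarkedᵇ (x ∸ 1) π ∧ c then just (s₀ , x ∸ 1)
    else if oneMarkedᵇ (x ∸ 2) π ∧ c then just (s₁ , x ∸ 2)
    else if oneMarkedᵇ (x + 2) π ∧ not (maybeEqᵇ prev (x + 2)) then just (s₂ , x + 2)
    else if oneMarkedᵇ x π then just (s₃ , x)
    else nothing
    where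
    c : Bool
    c = not (oneMarkedᵇ (x + 2) π) ∨ maybeEqᵇ prev (x + 2)

-- starting type of π^(2)_b  (nothing if b = 0, b > N₂, or no type applies)
stype : List ℕ → ℕ → Maybe SType
stype π zero = nothing
stype π (suc b) =
  if N 2 π <ᵇ suc b then nothing
  else if lIdx π <ᵇ suc b then just s₋₁
  else typeOf (stTyped π (suc b))
  where
  typeOf : Maybe (SType × ℕ) → Maybe SType
  typeOf (just (s , _)) = just s
  typeOf nothing        = nothing

InCeqPT : List ℕ → ℕ → ℕ → Set
InCeqPT π p t =
  InC33 π
  -- (1) largest odd part is 2t+1
  × ((2 * t + 1) ∈ π × (∀ x → x ∈ π → Odd x → x ≤ 2 * t + 1))
  -- (2) the mark of 2t+1 is at most 2
  × (∃[ m ] ((2 * t + 1 , m) ∈ GG π × m ≤ 2))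
  -- (3)
  × (mk 2 π p ≥∞ (2 * t + 2) × mk 2 π (suc p) ≤∞ (2 * t + 2))
  -- (4)
  × ((∃[ b ] (mk 2 π b ≡ fin (2 * t + 2) × stype π b ≡ just s₀)) →
       (mk 2 π (suc p) ≡ fin (2 * t + 2))
       × (∃[ i ] (i ≤ suc p
                  × mk 2 π i ≡ fin (2 * t + 2 + 4 * (suc p ∸ i))
                  × count (2 * t + 2 + 4 * (suc p ∸ i)) π ≡ 1)))
  -- (5)
  × ((∃[ b ] (mk 2 π b ≡ fin (2 * t + 2) × stype π b ≡ just s₂)) →
       mk 2 π p ≡ fin (2 * t + 2))
  -- (6)
  × (((2 * t + 2) ∈ π × ¬ ((2 * t + 2 , 2) ∈ GG π)) →
       (mk 2 π p ≡ fin (2 * t + 4))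
       × (stype π p ≡ just s₃)
       × (∃[ i ] (i ≤ p
                  × mk 2 π i ≡ fin (2 * t + 4 + 4 * (p ∸ i))
                  × ¬ ((2 * t + 4 + 4 * (p ∸ i) + 2) ∈ π))))

InCeq : List ℕ → ℕ → Set
InCeq π m = ∃[ p ] ∃[ t ] (p + t ≡ m × InCeqPT π p t)

-- In a partition of C(3,3) we have π_i ≥ π_{i+2} + 2 (strictly if π_i is even), so in the
-- Göllnitz–Gordon marking a part can only be close to the next smaller part.  Hence only the marks 1
-- and 2 occur, a part being 2-marked exactly when the next part is close to it and 1-marked, and the
-- 2-marked parts are strictly decreasing.
--
-- Condition (1) forces t: 2t+1 is the largest odd part.  Condition (3) places 2t+2 between
-- π^(2)_{p+1} and π^(2)_p, which determines p unless 2t+2 = π^(2)_q is itself 2-marked, when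
-- p ∈ {q-1, q}.  But if 2t+2 occurs at all, it occurs once and immediately before 2t+1, so it is
-- 2-marked and 2t+1 is 1-marked.  Its starting type is then s₀ or s₂, and conditions (4) and (5)
-- select p = q-1 and p = q respectively, while (6) is vacuous.
module Submission where

open import Defs
open import Data.Bool using (true; false; T; T?; _∧_; not; if_then_else_)
open import Data.Bool.Properties using (∧-zeroʳ; T-∧)
open import Data.Empty using (⊥; ⊥-elim)
open import Data.List using (List; []; _∷_; _++_; _ʳ++_; reverse; filter; filterᵇ; map; length; foldr)
open import Data.List.Membership.Propositional using (_∈_)
open import Data.List.Membership.Propositional.Properties
  using (∈-map∘filter⁺; ∈-filter⁺; ∈-upTo⁺; ∈-++⁺ˡ; ∈-++⁻)
open import Data.List.Properties using (reverse-involutive; filter-accept; filter-reject; filter-none)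
open import Data.List.Relation.Unary.All as All using (All; []; _∷_)
open import Data.List.Relation.Unary.All.Properties using (all⁻)
open import Data.List.Relation.Unary.AllPairs as AllPairs using ()
open import Data.List.Relation.Unary.Any as Any using (here; there)
open import Data.List.Relation.Unary.Any.Properties using (any⁺; any⁻)
open import Data.List.Relation.Unary.Linked as Linked using (Linked; []; [-]; _∷_)
open import Data.List.Relation.Unary.Linked.Properties using (Linked⇒AllPairs)
open import Data.Maybe as Maybe using (Maybe; just; nothing)
open import Data.Maybe.Properties using (just-injective)
open import Data.Nat
  using (ℕ; zero; suc; _+_; _*_; _∸_; _/_; _%_; _≤_; _<_; _≥_; _>_; _≤ᵇ_; _<ᵇ_; _≡ᵇ_; _⊔_; z≤n; s≤s)
open import Data.Nat.DivMod using (%-distribˡ-+; [m+kn]%n≡m%n; m≡m%n+[m/n]*n; m%n<n)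
open import Data.Nat.Properties
open import Data.List.Membership.DecPropositional _≟_ using (_∈?_)
open import Data.Product using (_×_; _,_; proj₁; proj₂; ∃₂; ∃-syntax; ∃!)
open import Data.Sum using (_⊎_; inj₁; inj₂)
open import Data.Unit using (⊤; tt)
open import Function using (_∘_)
open import Function.Bundles using (Equivalence)
open import Level using (0ℓ)
open import Relation.Binary.Core using (Rel)
open import Relation.Binary.Definitions using (Transitive; tri<; tri≈; tri>)
open import Relation.Binary.PropositionalEquality
open import Relation.Nullary using (¬_; Dec; yes; no)

odd⇒even-suc : ∀ n → Odd n → Even (suc n)
odd⇒even-suc n odd-n = trans (%-distribˡ-+ 1 n 2) (cong (λ r → (1 + r) % 2) odd-n)

odd⇒¬even : ∀ n → Odd n → ¬ Even n
odd⇒¬even n odd-n even-n with trans (sym odd-n) even-n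
... | ()

oddᵇ≡false⇒even : ∀ n → oddᵇ n ≡ false → Even n
oddᵇ≡false⇒even n parity with n % 2 | m%n<n n 2
oddᵇ≡false⇒even n _  | 0           | _            = refl
oddᵇ≡false⇒even n () | 1           | _
oddᵇ≡false⇒even n _  | suc (suc _) | s≤s (s≤s ())

odd+2-odd : ∀ n → Odd n → Odd (n + 2)
odd+2-odd n odd-n = trans ([m+kn]%n≡m%n n 1 2) odd-n

2t+1-odd : ∀ t → Odd (2 * t + 1)
2t+1-odd t = trans (cong (_% 2) (trans (+-comm (2 * t) 1) (cong suc (*-comm 2 t)))) ([m+kn]%n≡m%n 1 t 2)

odd⇒≡2[n/2]+1 : ∀ {n} → Odd n → n ≡ 2 * (n / 2) + 1
odd⇒≡2[n/2]+1 {n} odd-n = begin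
  n                   ≡⟨ m≡m%n+[m/n]*n n 2 ⟩
  n % 2 + n / 2 * 2   ≡⟨ cong (_+ n / 2 * 2) odd-n ⟩
  1 + n / 2 * 2       ≡⟨ +-comm 1 (n / 2 * 2) ⟩
  n / 2 * 2 + 1       ≡⟨ cong (_+ 1) (*-comm (n / 2) 2) ⟩
  2 * (n / 2) + 1     ∎
  where open ≡-Reasoning

T⇒≡true : ∀ {b} → T b → b ≡ true
T⇒≡true {true} _ = refl

¬T⇒≡false : ∀ {b} → ¬ T b → b ≡ false
¬T⇒≡false {true}  ¬t = ⊥-elim (¬t tt)
¬T⇒≡false {false} _  = refl

<ᵇ≡false : ∀ {m n} → n ≤ m → (m <ᵇ n) ≡ false
<ᵇ≡false n≤m = ¬T⇒≡false (λ m<n → <⇒≱ (<ᵇ⇒< _ _ m<n) n≤m)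

≤ᵇ≡false : ∀ {m n} → n < m → (m ≤ᵇ n) ≡ false
≤ᵇ≡false n<m = ¬T⇒≡false (λ m≤n → <⇒≱ n<m (≤ᵇ⇒≤ _ _ m≤n))

≥-trans : Transitive _≥_
≥-trans x≥y y≥z = ≤-trans y≥z x≥y

>-trans : Transitive _>_
>-trans x>y y>z = <-trans y>z x>y

head-dominates : ∀ {A : Set} {R : Rel A 0ℓ} {x xs} → Transitive R → Linked R (x ∷ xs) → All (R x) xs
head-dominates trans l = AllPairs.head (Linked⇒AllPairs trans l)

head-≥ : ∀ {x y xs} → Linked _≥_ (x ∷ xs) → y ∈ x ∷ xs → y ≤ x
head-≥ _    (here refl) = ≤-refl
head-≥ desc (there y∈)  = All.lookup (head-dominates ≥-trans desc) y∈

Linked-∷⁺ : ∀ {A : Set} {R : Rel A 0ℓ} {x xs} → All (R x) xs → Linked R xs → Linked R (x ∷ xs)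
Linked-∷⁺ {xs = []}    _         _ = [-]
Linked-∷⁺ {xs = _ ∷ _} (Rxy ∷ _) l = Rxy ∷ l

successor-adjacent : ∀ {π x} → Linked _≥_ π → x ∈ π → suc x ∈ π → ∃₂ λ A B → π ≡ A ++ suc x ∷ x ∷ B
successor-adjacent {y ∷ r} {x} desc x∈ sx∈ with x ∈? r | suc x ∈? r
... | yes x∈r | yes sx∈r with successor-adjacent (Linked.tail desc) x∈r sx∈r
...   | A , B , eq = y ∷ A , B , cong (y ∷_) eq
successor-adjacent desc (here refl) (here sx≡x)  | no _    | _ = ⊥-elim (1+n≢n sx≡x)
successor-adjacent desc (here refl) (there sx∈r) | no _    | _ = ⊥-elim (1+n≰n (head-≥ desc (there sx∈r)))
successor-adjacent desc (there x∈r) _            | no x∉r  | _ = ⊥-elim (x∉r x∈r)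
successor-adjacent desc _           (there sx∈r) | yes _   | no sx∉r = ⊥-elim (sx∉r sx∈r)
successor-adjacent {_ ∷ w ∷ r} {x} (sx≥w ∷ desc) _ (here refl) | yes x∈r | no sx∉r =
  [] , r , cong (λ w → suc x ∷ w ∷ r) w≡x
  where
  w≡x : w ≡ x
  w≡x = ≤-antisym (≤-pred (≤∧≢⇒< sx≥w (λ w≡sx → sx∉r (here (sym w≡sx))))) (head-≥ desc x∈r)

nth-∈ : ∀ M {i} → 1 ≤ i → i ≤ length M → nth M i ∈ M
nth-∈ (x ∷ M) {1}           _ _        = here refl
nth-∈ (x ∷ M) {suc (suc i)} _ (s≤s i≤) = there (nth-∈ M (s≤s z≤n) i≤)

∈⇒nth : ∀ {M x} → x ∈ M → ∃[ i ] (1 ≤ i × i ≤ length M × nth M i ≡ x)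
∈⇒nth {y ∷ M} (here refl) = 1 , ≤-refl , s≤s z≤n , refl
∈⇒nth {y ∷ M} (there x∈) with ∈⇒nth x∈
... | suc i , _ , i≤ , eq = suc (suc i) , s≤s z≤n , s≤s i≤ , eq

nth-descending : ∀ {M i i'} → Linked _>_ M → 1 ≤ i → i < i' → i' ≤ length M → nth M i' < nth M i
nth-descending {x ∷ M} {1}           {1}            _ _ (s≤s ())    _
nth-descending {x ∷ M} {1}           {suc (suc i')} l _ _           (s≤s i'≤) =
  All.lookup (head-dominates >-trans l) (nth-∈ M (s≤s z≤n) i'≤)
nth-descending {x ∷ M} {suc (suc i)} {suc (suc i')} l _ (s≤s i<i') (s≤s i'≤) =
  nth-descending (Linked.tail l) (s≤s z≤n) i<i' i'≤

∈⇒≤-foldr-⊔ : ∀ {x xs} → x ∈ xs → x ≤ foldr _⊔_ 0 xs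
∈⇒≤-foldr-⊔ {xs = y ∷ _} (here refl) = m≤m⊔n y _
∈⇒≤-foldr-⊔ {xs = y ∷ _} (there x∈)  = ≤-trans (∈⇒≤-foldr-⊔ x∈) (m≤n⊔m y _)

count-sole : ∀ {x} A {B} → All (_≢ x) A → All (_≢ x) B → count x (A ++ x ∷ B) ≡ 1
count-sole {x} [] {B} _ B≢x = cong length (begin
  filter P? (x ∷ B)  ≡⟨ filter-accept P? (≡⇒≡ᵇ x x refl) ⟩
  x ∷ filter P? B    ≡⟨ cong (x ∷_) (filter-none P? (All.map (λ y≢x → y≢x ∘ ≡ᵇ⇒≡ _ x) B≢x)) ⟩
  x ∷ []             ∎)
  where
  open ≡-Reasoning
  P? = λ y → T? (y ≡ᵇ x)
count-sole {x} (a ∷ A) {B} (a≢x ∷ A≢x) B≢x =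
  trans (cong length (filter-reject (λ y → T? (y ≡ᵇ x)) {a} {A ++ x ∷ B} (a≢x ∘ ≡ᵇ⇒≡ a x)))
        (count-sole A A≢x B≢x)

first-switch : ∀ {P : ℕ → Set} → (∀ n → Dec (P n)) → ¬ P 0 → ∀ n → P n → ∃[ p ] (¬ P p × P (suc p))
first-switch P? ¬P0 zero    P0  = ⊥-elim (¬P0 P0)
first-switch P? ¬P0 (suc n) Psn with P? n
... | yes Pn  = first-switch P? ¬P0 n Pn
... | no  ¬Pn = n , ¬Pn , Psn

-- The difference condition of C(3,3) between x = π_i and z = π_{i+2}.
Gap : ℕ → ℕ → Set
Gap x z = x ≥ z + 2 × (Even x → x > z + 2)

Gapped : List ℕ → Set
Gapped (x ∷ y ∷ z ∷ r) = Gap x z × Gapped (y ∷ z ∷ r)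
Gapped _               = ⊤

Spaced : List ℕ → Set
Spaced π = Linked _≥_ π × Gapped π

Gapped-tail : ∀ {x xs} → Gapped (x ∷ xs) → Gapped xs
Gapped-tail {xs = []}        _       = tt
Gapped-tail {xs = _ ∷ []}    _       = tt
Gapped-tail {xs = _ ∷ _ ∷ _} (_ , g) = g

Spaced-tail : ∀ {x xs} → Spaced (x ∷ xs) → Spaced xs
Spaced-tail (l , g) = Linked.tail l , Gapped-tail g

Spaced-++ʳ : ∀ A {B} → Spaced (A ++ B) → Spaced B
Spaced-++ʳ []      sp = sp
Spaced-++ʳ (_ ∷ A) sp = Spaced-++ʳ A (Spaced-tail sp)

Spaced-ʳ++ : ∀ A {B} → Spaced (A ʳ++ B) → Spaced B
Spaced-ʳ++ []      sp = sp
Spaced-ʳ++ (_ ∷ A) sp = Spaced-tail (Spaced-ʳ++ A sp)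

InC33⇒Spaced : ∀ {π} → InC33 π → Spaced π
InC33⇒Spaced {π} ((_ , desc) , _ , gaps , _) = desc , gapped π gaps
  where
  gapped : ∀ π → (∀ i → 1 ≤ i → i + 2 ≤ length π → Gap (nth π i) (nth π (i + 2))) → Gapped π
  gapped (x ∷ y ∷ z ∷ r) gaps =
    gaps 1 ≤-refl (s≤s (s≤s (s≤s z≤n))) ,
    gapped (y ∷ z ∷ r) (λ { (suc i) _ i+2≤ → gaps (suc (suc i)) (s≤s z≤n) (s≤s i+2≤) })
  gapped []           _ = tt
  gapped (_ ∷ [])     _ = tt
  gapped (_ ∷ _ ∷ []) _ = tt

Gap-antitone : ∀ {x z w} → w ≤ z → Gap x z → Gap x w
Gap-antitone w≤z (wide , wider) =
  ≤-trans (+-monoˡ-≤ 2 w≤z) wide , λ even → <-≤-trans (s≤s (+-monoˡ-≤ 2 w≤z)) (wider even)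

Gap⇒¬close : ∀ {x w} → Gap x w → closeᵇ x w ≡ false
Gap⇒¬close {x} {w} (wide , wider) with oddᵇ x in parity
... | true  = <ᵇ≡false (m+n≤o⇒m≤o∸n 2 (subst (_≤ x) (+-comm w 2) wide))
... | false =
  ≤ᵇ≡false (m+n≤o⇒m≤o∸n 3 (subst (_≤ x) (cong suc (+-comm w 2)) (wider (oddᵇ≡false⇒even x parity))))

Spaced⇒gap-beyond-next : ∀ {x y r} → Spaced (x ∷ y ∷ r) → All (Gap x) r
Spaced⇒gap-beyond-next {r = []}    _                        = []
Spaced⇒gap-beyond-next {r = z ∷ r} (_ ∷ _ ∷ desc , gap , _) =
  All.map (λ w≤z → Gap-antitone w≤z gap) (≤-refl ∷ head-dominates ≥-trans desc)

Spaced⇒far-beyond-next : ∀ {x y r} → Spaced (x ∷ y ∷ r) → All (λ w → closeᵇ x w ≡ false) r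
Spaced⇒far-beyond-next sp = All.map Gap⇒¬close (Spaced⇒gap-beyond-next sp)

Spaced⇒below-beyond-next : ∀ {x y r} → Spaced (x ∷ y ∷ r) → All (_< x) r
Spaced⇒below-beyond-next sp =
  All.map (λ gap → <-≤-trans (m<m+n _ 0<1+n) (proj₁ gap)) (Spaced⇒gap-beyond-next sp)

Spaced⇒above-pair : ∀ A {x y B} → Spaced (A ++ x ∷ y ∷ B) → All (λ a → y + 2 ≤ a) A
Spaced⇒above-pair []           _                 = []
Spaced⇒above-pair (a ∷ [])     (_ , gap , _)     = proj₁ gap ∷ []
Spaced⇒above-pair (a ∷ a' ∷ A) sp@(a≥a' ∷ _ , _) with Spaced⇒above-pair (a' ∷ A) (Spaced-tail sp)
... | a'-above ∷ above = ≤-trans a'-above a≥a' ∷ a'-above ∷ above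

-- In a spaced partition only the next smaller part can be close to x (Spaced⇒far-beyond-next),
-- so this is the Göllnitz–Gordon mark of x (GG-spaced).
markAfter : ℕ → List (ℕ × ℕ) → ℕ
markAfter x []            = 1
markAfter x ((y , m) ∷ _) = if closeᵇ x y ∧ (m ≡ᵇ 1) then 2 else 1

localMarks : List ℕ → List (ℕ × ℕ)
localMarks []      = []
localMarks (x ∷ r) = (x , markAfter x (localMarks r)) ∷ localMarks r

far-filtered-out : ∀ {x S} → All (λ w → closeᵇ x w ≡ false) S →
                   filterᵇ (λ p → closeᵇ x (proj₁ p)) (localMarks S) ≡ []
far-filtered-out []           = refl
far-filtered-out (far ∷ fars) rewrite far = far-filtered-out fars

newMark-spaced : ∀ {x S} → Spaced (x ∷ S) → newMark (localMarks S) x ≡ markAfter x (localMarks S)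
newMark-spaced {S = []}    _  = refl
newMark-spaced {x} {y ∷ S} sp with closeᵇ x y | far-filtered-out (Spaced⇒far-beyond-next sp)
... | false | none rewrite none = refl
... | true  | none rewrite none = firstFree-singleton (markAfter y (localMarks S))
  where
  firstFree-singleton : ∀ m → firstFree 2 1 (m ∷ []) ≡ (if m ≡ᵇ 1 then 2 else 1)
  firstFree-singleton 0             = refl
  firstFree-singleton 1             = refl
  firstFree-singleton (suc (suc m)) = refl

-- ggAsc runs through reverse π; L ʳ++ S is π with its smallest parts S already marked.
ggAsc-spaced : ∀ L S → Spaced (L ʳ++ S) → ggAsc (localMarks S) L ʳ++ localMarks S ≡ localMarks (L ʳ++ S)
ggAsc-spaced []      S _  = refl
ggAsc-spaced (x ∷ L) S sp rewrite newMark-spaced (Spaced-ʳ++ L sp) = ggAsc-spaced L (x ∷ S) sp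

GG-spaced : ∀ {π} → Spaced π → GG π ≡ localMarks π
GG-spaced {π} sp = begin
  ggAsc [] (reverse π) ʳ++ []
    ≡⟨ ggAsc-spaced (reverse π) [] (subst Spaced (sym (reverse-involutive π)) sp) ⟩
  localMarks (reverse (reverse π))
    ≡⟨ cong localMarks (reverse-involutive π) ⟩
  localMarks π
    ∎
  where open ≡-Reasoning

∈-localMarks-++⁺ : ∀ A {S p} → p ∈ localMarks S → p ∈ localMarks (A ++ S)
∈-localMarks-++⁺ []      p∈ = p∈
∈-localMarks-++⁺ (_ ∷ A) p∈ = there (∈-localMarks-++⁺ A p∈)

markAfter≤2 : ∀ x L → markAfter x L ≤ 2
markAfter≤2 x []            = s≤s z≤n
markAfter≤2 x ((y , m) ∷ _) with closeᵇ x y ∧ (m ≡ᵇ 1)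
... | true  = ≤-refl
... | false = s≤s z≤n

∈⇒marked-≤2 : ∀ {π x} → x ∈ π → ∃[ m ] ((x , m) ∈ localMarks π × m ≤ 2)
∈⇒marked-≤2 {y ∷ r} (here refl) = _ , here refl , markAfter≤2 y (localMarks r)
∈⇒marked-≤2 {y ∷ r} (there x∈) with ∈⇒marked-≤2 x∈
... | m , p , m≤2 = m , there p , m≤2

markAfter-2≡1 : ∀ x y L → markAfter x ((y , 2) ∷ L) ≡ 1
markAfter-2≡1 x y L rewrite ∧-zeroʳ (closeᵇ x y) = refl

next-of-2-marked-is-1-marked : ∀ {x y} r → markAfter x (localMarks (y ∷ r)) ≡ 2 →
                               markAfter y (localMarks r) ≡ 1
next-of-2-marked-is-1-marked {x} {y} r eq with closeᵇ x y | markAfter y (localMarks r) ≡ᵇ 1 in m≡ᵇ1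
... | true  | true  = ≡ᵇ⇒≡ _ 1 (subst T (sym m≡ᵇ1) tt)
... | true  | false with () ← eq
... | false | _     with () ← eq

selectMark : ℕ → List (ℕ × ℕ) → List ℕ
selectMark j L = map proj₁ (filterᵇ (λ p → proj₂ p ≡ᵇ j) L)

∈-selectMark⁺ : ∀ {x j L} → (x , j) ∈ L → x ∈ selectMark j L
∈-selectMark⁺ {x} {j} x∈ =
  ∈-map∘filter⁺ proj₁ (λ p → T? (proj₂ p ≡ᵇ j)) ((x , j) , x∈ , refl , ≡⇒≡ᵇ j j refl)

selectMark-localMarks-⊆ : ∀ {j π w} → w ∈ selectMark j (localMarks π) → w ∈ π
selectMark-localMarks-⊆ {j} {x ∷ r} w∈ with markAfter x (localMarks r) ≡ᵇ j
selectMark-localMarks-⊆ {j} {x ∷ r} (here refl) | true = here refl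
selectMark-localMarks-⊆ {j} {x ∷ r} (there w∈)  | true = there (selectMark-localMarks-⊆ w∈)
selectMark-localMarks-⊆ {j} {x ∷ r} w∈          | false = there (selectMark-localMarks-⊆ w∈)

two-marked-descending : ∀ {π} → Spaced π → Linked _>_ (selectMark 2 (localMarks π))
two-marked-descending {[]}    _  = []
two-marked-descending {x ∷ r} sp with markAfter x (localMarks r) ≡ᵇ 2 in is2
... | false = two-marked-descending (Spaced-tail sp)
... | true  =
  Linked-∷⁺ (below r sp (≡ᵇ⇒≡ _ 2 (subst T (sym is2) tt))) (two-marked-descending (Spaced-tail sp))
  where
  below : ∀ r → Spaced (x ∷ r) → markAfter x (localMarks r) ≡ 2 → All (_< x) (selectMark 2 (localMarks r))
  below []       _  ()
  below (y ∷ r') sp x-marked-2 = All.tabulate λ {w} w∈ →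
    All.lookup (Spaced⇒below-beyond-next sp)
      (selectMark-localMarks-⊆ (subst (λ m → w ∈ selectMark 2 ((y , m) ∷ localMarks r'))
                                      (next-of-2-marked-is-1-marked r' x-marked-2) w∈))

marked-spaced : ∀ {j π} → Spaced π → marked j π ≡ selectMark j (localMarks π)
marked-spaced sp = cong (selectMark _) (GG-spaced sp)

marked-2-descending : ∀ {π} → Spaced π → Linked _>_ (marked 2 π)
marked-2-descending sp = subst (Linked _>_) (sym (marked-spaced sp)) (two-marked-descending sp)

marked-⊆ : ∀ {j π w} → Spaced π → w ∈ marked j π → w ∈ π
marked-⊆ sp w∈ = selectMark-localMarks-⊆ (subst (_ ∈_) (marked-spaced sp) w∈)

_≤∞?_ : ∀ a n → Dec (a ≤∞ n)
-∞    ≤∞? n = yes tt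
fin a ≤∞? n = a ≤? n
+∞    ≤∞? n = no λ ()

≰∞⇒≥∞ : ∀ {a n} → ¬ (a ≤∞ n) → a ≥∞ n
≰∞⇒≥∞ { -∞}   a≰n = a≰n tt
≰∞⇒≥∞ {fin a} a≰n = <⇒≤ (≰⇒> a≰n)
≰∞⇒≥∞ {+∞}    _   = tt

module MarkedSequence (j : ℕ) (π : List ℕ) where

  mk-fin⁻ : ∀ i {v} → mk j π i ≡ fin v → 1 ≤ i × i ≤ N j π × nth (marked j π) i ≡ v
  mk-fin⁻ (suc i) eq with suc i ≤ᵇ N j π in in-range
  mk-fin⁻ (suc i) refl | true  = s≤s z≤n , ≤ᵇ⇒≤ _ _ (subst T (sym in-range) tt) , refl
  mk-fin⁻ (suc i) ()   | false

  mk-fin⁺ : ∀ {i} → 1 ≤ i → i ≤ N j π → mk j π i ≡ fin (nth (marked j π) i)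
  mk-fin⁺ {suc i} _ i≤N with suc i ≤ᵇ N j π | ≤⇒≤ᵇ i≤N
  ... | true | _ = refl

  mk-beyond : ∀ {i} → N j π < i → mk j π i ≡ -∞
  mk-beyond {suc i} N<i rewrite ≤ᵇ≡false N<i = refl

  mk-suc≢+∞ : ∀ i → mk j π (suc i) ≢ +∞
  mk-suc≢+∞ i eq with suc i ≤ᵇ N j π
  mk-suc≢+∞ i () | true
  mk-suc≢+∞ i () | false

  mk-fin⇒∈ : ∀ {i v} → mk j π i ≡ fin v → v ∈ marked j π
  mk-fin⇒∈ {i} eq with mk-fin⁻ i eq
  ... | 1≤i , i≤N , refl = nth-∈ (marked j π) 1≤i i≤N

  ∈⇒mk-fin : ∀ {v} → v ∈ marked j π → ∃[ i ] mk j π i ≡ fin v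
  ∈⇒mk-fin v∈ with ∈⇒nth v∈
  ... | i , 1≤i , i≤N , refl = i , mk-fin⁺ 1≤i i≤N

  mk-suc-≥∞⇒fin : ∀ i {v} → mk j π (suc i) ≥∞ v → ∃[ u ] (mk j π (suc i) ≡ fin u × v ≤ u)
  mk-suc-≥∞⇒fin i above with mk j π (suc i) in eq
  ... | fin u = u , refl , above
  ... | +∞    = ⊥-elim (mk-suc≢+∞ i eq)

  crossing : ∀ v → ∃[ p ] (mk j π p ≥∞ v × mk j π (suc p) ≤∞ v)
  crossing v with first-switch (λ i → mk j π i ≤∞? v) (λ ()) (suc (N j π)) beyond
    where beyond = subst (_≤∞ v) (sym (mk-beyond ≤-refl)) tt
  ... | p , p≰ , p+1≤ = p , ≰∞⇒≥∞ p≰ , p+1≤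

  module _ (desc : Linked _>_ (marked j π)) where

    mk-descending : ∀ {i i' u v} → i < i' → mk j π i ≡ fin u → mk j π i' ≡ fin v → v < u
    mk-descending {i} {i'} i<i' eq eq' with mk-fin⁻ i eq | mk-fin⁻ i' eq'
    ... | 1≤i , _ , refl | _ , i'≤N , refl = nth-descending desc 1≤i i<i' i'≤N

    mk-injective : ∀ i i' {v} → mk j π i ≡ fin v → mk j π i' ≡ fin v → i ≡ i'
    mk-injective i i' eq eq' with <-cmp i i'
    ... | tri< i<i' _ _ = ⊥-elim (<-irrefl refl (mk-descending i<i' eq eq'))
    ... | tri≈ _ i≡i' _ = i≡i'
    ... | tri> _ _ i>i' = ⊥-elim (<-irrefl refl (mk-descending i>i' eq' eq))

    mk-above : ∀ {q i v} → mk j π q ≡ fin v → i < q → mk j π i ≥∞ v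
    mk-above {i = zero}  _  _   = tt
    mk-above {q} {suc i} eq i<q with mk-fin⁻ q eq
    ... | _ , q≤N , _ = subst (_≥∞ _) (sym at-i) (<⇒≤ (mk-descending i<q at-i eq))
      where at-i = mk-fin⁺ (s≤s z≤n) (≤-trans (<⇒≤ i<q) q≤N)

    mk-below : ∀ {q i v} → mk j π q ≡ fin v → q < i → mk j π i ≤∞ v
    mk-below {i = i} eq q<i with i ≤? N j π
    ... | no  i≰N = subst (_≤∞ _) (sym (mk-beyond (≰⇒> i≰N))) tt
    ... | yes i≤N = subst (_≤∞ _) (sym at-i) (<⇒≤ (mk-descending q<i eq at-i))
      where at-i = mk-fin⁺ (≤-trans (s≤s z≤n) q<i) i≤N

    crossing-adjacent : ∀ {p p' v} → p < p' → mk j π (suc p) ≤∞ v → mk j π p' ≥∞ v →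
                        p' ≡ suc p × mk j π p' ≡ fin v
    crossing-adjacent {p} {suc p'} {v} p<p' below above with mk-suc-≥∞⇒fin p' above
    ... | u , at-p' , v≤u with m≤n⇒m<n∨m≡n p<p'
    ...   | inj₂ refl     = refl , trans at-p' (cong fin (≤-antisym (subst (_≤∞ v) at-p' below) v≤u))
    ...   | inj₁ p+1<p' =
      ⊥-elim (<⇒≱ (mk-descending p+1<p' at-p+1 at-p') (≤-trans (subst (_≤∞ v) at-p+1 below) v≤u))
      where at-p+1 = mk-fin⁺ (s≤s z≤n) (≤-trans p<p' (proj₁ (proj₂ (mk-fin⁻ (suc p') at-p'))))

LargestOdd : List ℕ → ℕ → Set
LargestOdd π o = o ∈ π × (∀ x → x ∈ π → Odd x → x ≤ o)

first-odd-is-largest : ∀ {π x} → Linked _≥_ π → x ∈ π → Odd x → ∃[ o ] (Odd o × LargestOdd π o)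
first-odd-is-largest {y ∷ r} desc x∈ odd-x with y % 2 ≟ 1
... | yes odd-y = y , odd-y , here refl , λ z z∈ _ → head-≥ desc z∈
... | no ¬odd-y with x∈
...   | here refl = ⊥-elim (¬odd-y odd-x)
...   | there x∈r with first-odd-is-largest (Linked.tail desc) x∈r odd-x
...     | o , odd-o , o∈ , o-max = o , odd-o , there o∈ , λ { z (here refl) odd-z → ⊥-elim (¬odd-y odd-z)
                                                         ; z (there z∈) odd-z → o-max z z∈ odd-z }

largest-odd-exists : ∀ {π x} → Linked _≥_ π → x ∈ π → Odd x → ∃[ t ] LargestOdd π (2 * t + 1)
largest-odd-exists desc x∈ odd-x with first-odd-is-largest desc x∈ odd-x
... | o , odd-o , largest = o / 2 , subst (LargestOdd _) (odd⇒≡2[n/2]+1 odd-o) largest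

largest-odd-unique : ∀ {π t t'} → LargestOdd π (2 * t + 1) → LargestOdd π (2 * t' + 1) → t ≡ t'
largest-odd-unique {t = t} {t'} (o∈ , o-max) (o'∈ , o'-max) =
  *-cancelˡ-≡ t t' 2 (+-cancelʳ-≡ 1 (2 * t) (2 * t')
    (≤-antisym (o'-max _ o∈ (2t+1-odd t)) (o-max _ o'∈ (2t+1-odd t'))))

close-suc : ∀ x → closeᵇ (suc x) x ≡ true
close-suc x rewrite m+n∸n≡m 1 x with oddᵇ (suc x)
... | true  = refl
... | false = refl

markAfter-odd≡1 : ∀ {o} B → Odd o → Spaced (suc o ∷ o ∷ B) → markAfter o (localMarks B) ≡ 1
markAfter-odd≡1 []            _     _                     = refl
markAfter-odd≡1 {o} (w ∷ _) odd-o (_ , (_ , wider) , _)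
  rewrite Gap⇒¬close {o} {w} (≤-pred (wider (odd⇒even-suc o odd-o)) , ⊥-elim ∘ odd⇒¬even o odd-o) = refl

markAfter-successor≡2 : ∀ {o} B → Odd o → Spaced (suc o ∷ o ∷ B) →
                        markAfter (suc o) (localMarks (o ∷ B)) ≡ 2
markAfter-successor≡2 {o} B odd-o sp rewrite markAfter-odd≡1 B odd-o sp | close-suc o = refl

module _ {o} A {B} (odd-o : Odd o) (sp : Spaced (A ++ suc o ∷ o ∷ B)) where

  private
    pair-spaced : Spaced (suc o ∷ o ∷ B)
    pair-spaced = Spaced-++ʳ A sp

  odd-1-marked : (o , 1) ∈ localMarks (A ++ suc o ∷ o ∷ B)
  odd-1-marked = ∈-localMarks-++⁺ A (there (subst (λ m → (o , m) ∈ localMarks (o ∷ B))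
                                                  (markAfter-odd≡1 B odd-o pair-spaced) (here refl)))

  successor-2-marked : (suc o , 2) ∈ localMarks (A ++ suc o ∷ o ∷ B)
  successor-2-marked = ∈-localMarks-++⁺ A (subst (λ m → (suc o , m) ∈ localMarks (suc o ∷ o ∷ B))
                                                (markAfter-successor≡2 B odd-o pair-spaced) (here refl))

  successor-once : count (suc o) (A ++ suc o ∷ o ∷ B) ≡ 1
  successor-once =
    count-sole A (All.map (λ o+2≤a → <⇒≢ (≤-trans (≤-reflexive (+-comm 2 o)) o+2≤a) ∘ sym)
                          (Spaced⇒above-pair A sp))
                 (All.tabulate (λ y∈ → <⇒≢ (s≤s (head-≥ (Linked.tail (proj₁ pair-spaced)) y∈))))

above-successor-1-marked : ∀ A {o B} → Odd o → Spaced (A ++ suc o ∷ o ∷ B) → (∀ x → x ∈ A → Odd x → x ≤ o) →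
                           suc o + 2 ∈ A → (suc o + 2 , 1) ∈ localMarks (A ++ suc o ∷ o ∷ B)
above-successor-1-marked (a ∷ []) {o} {B} odd-o sp _ (here refl) =
  here (cong (a ,_) (sym (subst (λ m → markAfter a ((suc o , m) ∷ localMarks (o ∷ B)) ≡ 1)
                                (sym (markAfter-successor≡2 B odd-o (Spaced-tail sp)))
                                (markAfter-2≡1 a (suc o) (localMarks (o ∷ B))))))
above-successor-1-marked (a ∷ a' ∷ A) {o} odd-o sp@(a≥a' ∷ _ , _) o-max (here refl) =
  there (above-successor-1-marked (a' ∷ A) odd-o (Spaced-tail sp) (λ x → o-max x ∘ there) (here a≡a'))
  where
  o+2≤a' : o + 2 ≤ a'
  o+2≤a' = All.head (All.tail (Spaced⇒above-pair (a ∷ a' ∷ A) sp))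
  a'≢o+2 : a' ≢ o + 2
  a'≢o+2 a'≡o+2 = <⇒≱ (m<m+n o 0<1+n)
    (subst (_≤ o) a'≡o+2 (o-max a' (there (here refl)) (subst Odd (sym a'≡o+2) (odd+2-odd o odd-o))))
  a≡a' : a ≡ a'
  a≡a' = ≤-antisym (≤∧≢⇒< o+2≤a' (a'≢o+2 ∘ sym)) a≥a'
above-successor-1-marked (a ∷ A) odd-o sp o-max (there a∈A) =
  there (above-successor-1-marked A odd-o (Spaced-tail sp) (λ x → o-max x ∘ there) a∈A)

record SuccessorOfLargestOdd (π : List ℕ) (o : ℕ) : Set where
  field
    successor-mark  : (suc o , 2) ∈ localMarks π
    odd-mark        : (o , 1) ∈ localMarks π
    successor-count : count (suc o) π ≡ 1
    above-mark      : suc o + 2 ∈ π → (suc o + 2 , 1) ∈ localMarks π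

successor-of-largest-odd : ∀ {π o} → Spaced π → Odd o → LargestOdd π o → suc o ∈ π →
                           SuccessorOfLargestOdd π o
successor-of-largest-odd {o = o} sp odd-o (o∈ , o-max) so∈ with successor-adjacent (proj₁ sp) o∈ so∈
... | A , B , refl = record
  { successor-mark  = successor-2-marked A odd-o sp
  ; odd-mark        = odd-1-marked A odd-o sp
  ; successor-count = successor-once A odd-o sp
  ; above-mark      = above-successor-1-marked A odd-o sp (λ x → o-max x ∘ ∈-++⁺ˡ) ∘ in-prefix
  }
  where
  in-prefix : suc o + 2 ∈ A ++ suc o ∷ o ∷ B → suc o + 2 ∈ A
  in-prefix o+3∈ with ∈-++⁻ A o+3∈
  ... | inj₁ o+3∈A = o+3∈A
  ... | inj₂ o+3∈ʳ = ⊥-elim (<⇒≱ (m<m+n (suc o) 0<1+n) (head-≥ (proj₁ (Spaced-++ʳ A sp)) o+3∈ʳ))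

oneMarkedᵇ-complete : ∀ {x π} → (x , 1) ∈ GG π → oneMarkedᵇ x π ≡ true
oneMarkedᵇ-complete {x} x∈ =
  T⇒≡true (any⁺ _ (Any.map (λ { refl → Equivalence.from T-∧ (≡⇒≡ᵇ x x refl , tt) }) x∈))

occursᵇ-sound : ∀ {x π} → occursᵇ x π ≡ true → x ∈ π
occursᵇ-sound {x} {π} occurs = Any.map (λ y≡ᵇx → sym (≡ᵇ⇒≡ _ x y≡ᵇx)) (any⁻ _ π (subst T (sym occurs) tt))

≤-lIdx : ∀ {π i} → i ≤ N 2 π → T (lCond π i) → i ≤ lIdx π
≤-lIdx {π} i≤N cond = ∈⇒≤-foldr-⊔ (∈-filter⁺ (T? ∘ lCond π) (∈-upTo⁺ (s≤s i≤N)) cond)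

lCond-below : ∀ {π i v} → mk 2 π i ≡ fin v → (∀ x → x ∈ π → Odd x → x < v) → T (lCond π i)
lCond-below {π} {i} {v} at-i odd-below = all⁻ _ (All.tabulate no-odd-above)
  where
  no-odd-above : ∀ {x} → x ∈ π → T (not (oddᵇ x ∧ (mk 2 π i ≤∞ᵇ x)))
  no-odd-above {x} x∈ rewrite at-i with oddᵇ x in parity
  ... | false = tt
  ... | true rewrite ≤ᵇ≡false (odd-below x x∈ (≡ᵇ⇒≡ _ 1 (subst T (sym parity) tt))) = tt

stype-in-range : ∀ π b → suc b ≤ N 2 π → suc b ≤ lIdx π →
                 stype π (suc b) ≡ Maybe.map proj₁ (stTyped π (suc b))
stype-in-range π b ≤N ≤lIdx rewrite <ᵇ≡false ≤N | <ᵇ≡false ≤lIdx with stTyped π (suc b)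
... | just _  = refl
... | nothing = refl

S₀orS₂ : Maybe SType → Set
S₀orS₂ s = s ≡ just s₀ ⊎ s ≡ just s₂

s₂≢s₀ : s₂ ≢ s₀
s₂≢s₀ ()

-- With x ∸ 1 1-marked, type s₀ can only fail because of a 1-marked x + 2 that is not s_{b-1}(π),
-- and that part then gives type s₂.
stTyped-below-1-marked : ∀ π b {x} → nth (marked 2 π) (suc b) ≡ x → oneMarkedᵇ (x ∸ 1) π ≡ true →
                         (occursᵇ (x + 2) π ≡ true → oneMarkedᵇ (x + 2) π ≡ true) →
                         S₀orS₂ (Maybe.map proj₁ (stTyped π (suc b)))
stTyped-below-1-marked π zero {x} at-1 below above rewrite at-1 with occursᵇ (x + 2) π in occurs
... | false rewrite below = inj₁ refl
... | true  rewrite above refl | ∧-zeroʳ (oneMarkedᵇ (x ∸ 1) π) | ∧-zeroʳ (oneMarkedᵇ (x ∸ 2) π) = inj₂ refl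
stTyped-below-1-marked π (suc b) {x} at-b below _ rewrite at-b
  with oneMarkedᵇ (x + 2) π | maybeEqᵇ (sval (stTyped π (suc b))) (x + 2)
... | false | _     rewrite below = inj₁ refl
... | true  | true  rewrite below = inj₁ refl
... | true  | false rewrite ∧-zeroʳ (oneMarkedᵇ (x ∸ 1) π) | ∧-zeroʳ (oneMarkedᵇ (x ∸ 2) π) = inj₂ refl

module _ {π o} (sp : Spaced π) (odd-o : Odd o) (largest : LargestOdd π o) where

  open MarkedSequence 2 π

  stype-successor-of-largest-odd : ∀ q → mk 2 π q ≡ fin (suc o) → S₀orS₂ (stype π q)
  stype-successor-of-largest-odd (suc b) at-q with mk-fin⁻ (suc b) at-q
  ... | _ , q≤N , at-q-is-suc-o =
    subst S₀orS₂ (sym (stype-in-range π b q≤N q≤lIdx))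
          (stTyped-below-1-marked π b at-q-is-suc-o (oneMarkedᵇ-complete {π = π} (in-GG odd-mark))
                                  (oneMarkedᵇ-complete {π = π} ∘ in-GG ∘ above-mark ∘ occursᵇ-sound {π = π}))
    where
    open SuccessorOfLargestOdd (successor-of-largest-odd sp odd-o largest (marked-⊆ sp (mk-fin⇒∈ at-q)))
    in-GG : ∀ {p} → p ∈ localMarks π → p ∈ GG π
    in-GG = subst (_ ∈_) (sym (GG-spaced sp))
    q≤lIdx = ≤-lIdx {π} q≤N (lCond-below {π} at-q (λ x x∈ odd-x → s≤s (proj₂ largest x x∈ odd-x)))

T+4*[n∸n]≡T : ∀ T n → T + 4 * (n ∸ n) ≡ T
T+4*[n∸n]≡T T n rewrite n∸n≡0 n = +-identityʳ T

module _ {π t} (c33 : InC33 π) (largest : LargestOdd π (2 * t + 1)) where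

  open MarkedSequence 2 π

  private
    sp : Spaced π
    sp = InC33⇒Spaced c33

    desc : Linked _>_ (marked 2 π)
    desc = marked-2-descending sp

    odd-o : Odd (2 * t + 1)
    odd-o = 2t+1-odd t

    T≡suc-o : 2 * t + 2 ≡ suc (2 * t + 1)
    T≡suc-o = +-suc (2 * t) 1

    stype-at-T : ∀ q → mk 2 π q ≡ fin (2 * t + 2) → S₀orS₂ (stype π q)
    stype-at-T q at-q = stype-successor-of-largest-odd sp odd-o largest q (trans at-q (cong fin T≡suc-o))

    occurs : ∀ b {v} → mk 2 π b ≡ fin v → v ∈ π
    occurs b at-b = marked-⊆ sp (mk-fin⇒∈ {b} at-b)

    same-type : ∀ b q {s s'} → mk 2 π b ≡ fin (2 * t + 2) → mk 2 π q ≡ fin (2 * t + 2) →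
                stype π b ≡ just s → stype π q ≡ just s' → s ≡ s'
    same-type b q at-b at-q type-b type-q with mk-injective desc b q at-b at-q
    ... | refl = just-injective (trans (sym type-b) type-q)

  odd-mark-≤2 : ∃[ m ] ((2 * t + 1 , m) ∈ GG π × m ≤ 2)
  odd-mark-≤2 with ∈⇒marked-≤2 (proj₁ largest)
  ... | m , marked-m , m≤2 = m , subst (_ ∈_) (sym (GG-spaced sp)) marked-m , m≤2

  existence-without-T : ¬ (2 * t + 2 ∈ π) → ∃[ p ] InCeqPT π p t
  existence-without-T T∉ with crossing (2 * t + 2)
  ... | p , above , below = p , c33 , largest , odd-mark-≤2 , (above , below) ,
                            (λ (b , at-b , _) → ⊥-elim (T∉ (occurs b at-b))) ,
                            (λ (b , at-b , _) → ⊥-elim (T∉ (occurs b at-b))) ,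
                            (λ (T∈ , _) → ⊥-elim (T∉ T∈))

  existence-with-T : 2 * t + 2 ∈ π → ∃[ p ] InCeqPT π p t
  existence-with-T T∈ = let q , at-q = position in from-position q at-q (stype-at-T q at-q)
    where
    open SuccessorOfLargestOdd (successor-of-largest-odd sp odd-o largest (subst (_∈ π) T≡suc-o T∈))

    T-2-marked : (2 * t + 2 , 2) ∈ GG π
    T-2-marked = subst (λ T → (T , 2) ∈ GG π) (sym T≡suc-o) (subst (_ ∈_) (sym (GG-spaced sp)) successor-mark)

    position : ∃[ q ] mk 2 π q ≡ fin (2 * t + 2)
    position = ∈⇒mk-fin (∈-selectMark⁺ T-2-marked)

    T-once : ∀ n → count (2 * t + 2 + 4 * (n ∸ n)) π ≡ 1
    T-once n = subst (λ T → count T π ≡ 1) (sym (trans (T+4*[n∸n]≡T _ n) T≡suc-o)) successor-count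

    from-position : ∀ q → mk 2 π q ≡ fin (2 * t + 2) → S₀orS₂ (stype π q) → ∃[ p ] InCeqPT π p t
    from-position zero    ()   _
    from-position (suc p) at-q (inj₁ type-s₀) =
      p , c33 , largest , odd-mark-≤2 ,
      (mk-above desc at-q ≤-refl , subst (_≤∞ _) (sym at-q) ≤-refl) ,
      (λ _ → at-q , suc p , ≤-refl , subst (λ T → mk 2 π (suc p) ≡ fin T) (sym (T+4*[n∸n]≡T _ p)) at-q , T-once p) ,
      (λ (b , at-b , type-s₂) → ⊥-elim (s₂≢s₀ (same-type b (suc p) at-b at-q type-s₂ type-s₀))) ,
      (λ (_ , ¬T-2-marked) → ⊥-elim (¬T-2-marked T-2-marked))
    from-position q at-q (inj₂ type-s₂) =
      q , c33 , largest , odd-mark-≤2 ,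
      (subst (_≥∞ _) (sym at-q) ≤-refl , mk-below desc at-q ≤-refl) ,
      (λ (b , at-b , type-s₀) → ⊥-elim (s₂≢s₀ (same-type q b at-q at-b type-s₂ type-s₀))) ,
      (λ _ → at-q) ,
      (λ (_ , ¬T-2-marked) → ⊥-elim (¬T-2-marked T-2-marked))

  existence : ∃[ p ] InCeqPT π p t
  existence with (2 * t + 2) ∈? π
  ... | no  T∉ = existence-without-T T∉
  ... | yes T∈ = existence-with-T T∈

  smaller-p-impossible : ∀ {p p'} → p < p' → InCeqPT π p t → InCeqPT π p' t → ⊥
  smaller-p-impossible {p} {p'} p<p' (_ , _ , _ , (_ , below) , _ , cond5 , _) (_ , _ , _ , (above' , _) , cond4' , _)
    with crossing-adjacent desc p<p' below above'
  ... | refl , at-p' with stype-at-T p' at-p'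
  ...   | inj₁ type-s₀ = 1+n≢n (mk-injective desc (suc p') p' (proj₁ (cond4' (p' , at-p' , type-s₀))) at-p')
  ...   | inj₂ type-s₂ = <-irrefl (mk-injective desc p p' (cond5 (p' , at-p' , type-s₂)) at-p') p<p'

  p-unique : ∀ {p p'} → InCeqPT π p t → InCeqPT π p' t → p ≡ p'
  p-unique {p} {p'} in-p in-p' with <-cmp p p'
  ... | tri< p<p' _ _ = ⊥-elim (smaller-p-impossible p<p' in-p in-p')
  ... | tri≈ _ p≡p' _ = p≡p'
  ... | tri> _ _ p>p' = ⊥-elim (smaller-p-impossible p>p' in-p' in-p)

p+t-unique : ∀ {π p t p' t'} → InCeqPT π p t → InCeqPT π p' t' → p + t ≡ p' + t'
p+t-unique {t = t} {t' = t'} in-pt@(c33 , largest , _) in-pt'@(_ , largest' , _)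
  with largest-odd-unique {t = t} {t'} largest largest'
... | refl = cong (_+ t) (p-unique {t = t} c33 largest in-pt in-pt')

theorem5p5 : (π : List ℕ) → InC33 π → (∃[ x ] (x ∈ π × Odd x)) →
    ∃! _≡_ (λ m → InCeq π m)
theorem5p5 π c33 (x , x∈ , odd-x) with largest-odd-exists (proj₂ (proj₁ c33)) x∈ odd-x
... | t , largest with existence {t = t} c33 largest
...   | p , in-pt =
  p + t , (p , t , refl , in-pt) , λ (p' , t' , p'+t'≡m , in-pt') → trans (p+t-unique in-pt in-pt') p'+t'≡m
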